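{- Let $\lambda$ and $\mu$ be partitions (not necessarily with $\mu\subseteq\lambda$), and let $k\in\operatorname{ER}(\mu)$. Let $\mathbf{b}=(b_1,b_2,\ldots)$ be the flagging induced by $\lambda/\mu$ and $\mathbf{b}^*=(b^*_1,b^*_2,\ldots)$ the flagging induced by $\lambda/\mu^{+k}$. Then: (a) if $m_k\notin\Delta(\lambda)$, then $b^*_i=b_i$ for each $i\ge1$; (b) if $m_k\in\Delta(\lambda)$, then $b^*_i=b_i-[k=i]$ for each $i\ge1$; (c) if $i$ is a positive integer with $i\ne k$, then $b^*_i=b_i$.
   Context: $m_i=\mu_i-i$; $\Delta(\lambda)=\{\lambda_i-i:i\ge1\}$. $\mu^{+k}$ is the sequence obtained from $\mu$ by adding $1$ to its $k$-th entry; $\operatorname{ER}(\mu)$ is the set of positive integers $k$ with $k=1$ or $\mu_k\ne\mu_{k-1}$ (exactly those $k$ for which $\mu^{+k}$ is a partition). For partitions $\lambda,\nu$, the flagging induced by $\lambda/\nu$ is $b_i=\max\{k\ge0:\lambda_k-k\ge\nu_i-i\}$ with $\lambda_0=+\infty$. $[X]$ is the Iverson bracket. -}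

module Defs where

open import Data.Nat using (ℕ; zero; suc; _≤_; _≥_; _<_) renaming (_≟_ to _≟ℕ_)
open import Data.Integer using (ℤ; +_; _-_) renaming (_≥_ to _≥ℤ_)
open import Data.Product using (Σ; _×_; ∃-syntax)
open import Data.Sum using (_⊎_)
open import Relation.Binary.PropositionalEquality using (_≡_; _≢_)
open import Relation.Nullary using (yes; no)

-- Sequences are indexed 1-based: s i is the i-th entry for i ≥ 1;
-- the value at index 0 is never used.
Seq : Set
Seq = ℕ → ℕ

record IsPartition (μ : Seq) : Set where
  field
    decreasing : ∀ i → 1 ≤ i → μ (suc i) ≤ μ i
    eventuallyZero : ∃[ N ] (∀ i → N ≤ i → μ i ≡ 0)

m : Seq → ℕ → ℤ
m μ i = + μ i - + i

_∈Δ_ : ℤ → Seq → Set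
x ∈Δ lam = ∃[ j ] (1 ≤ j × m lam j ≡ x)

plus : Seq → ℕ → Seq
plus μ k j with j ≟ℕ k
... | yes _ = suc (μ j)
... | no  _ = μ j

ER : Seq → ℕ → Set
ER μ zero = Data.Empty.⊥ where import Data.Empty
ER μ (suc zero) = Data.Unit.⊤ where import Data.Unit
ER μ (suc (suc j)) = μ (suc (suc j)) ≢ μ (suc j)

-- The set { k ≥ 0 : λ_k - k ≥ ν_i - i } with λ_0 = +∞ (so 0 always belongs).
FlagSet : Seq → Seq → ℕ → ℕ → Set
FlagSet lam ν i k = k ≡ 0 ⊎ (1 ≤ k × m lam k ≥ℤ m ν i)

IsMax : (ℕ → Set) → ℕ → Set
IsMax P b = P b × (∀ k → P k → k ≤ b)

IsFlag : Seq → Seq → ℕ → ℕ → Set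
IsFlag lam ν i b = IsMax (FlagSet lam ν i) b

iverson : ℕ → ℕ → ℕ
iverson k i with k ≟ℕ i
... | yes _ = 1
... | no  _ = 0

{-# OPTIONS --safe #-}
-- The i-th flag entry only depends on the threshold m_i = ν_i − i: it is the largest j with
-- λ_j − j ≥ m_i.  Passing from μ to μ^{+k} raises the threshold by one at i = k and nowhere
-- else.  Since j ↦ λ_j − j is strictly decreasing, raising the threshold from y to y + 1
-- changes the largest such j only if y = λ_j − j for some j, and then it drops by exactly one.
module Submission where

open import Defs
open import Data.Nat using (ℕ; zero; suc; _≤_; _<_; z≤n; s≤s; _≤′_; ≤′-refl; ≤′-step; _≟_; _≤?_)
import Data.Nat.Properties as ℕ
open import Data.Integer using (ℤ; +_; -_; _-_; _⊖_) renaming (_≤_ to _≤ℤ_; _<_ to _<ℤ_; suc to sucℤ)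
import Data.Integer.Properties as ℤ
open import Data.Product using (_×_; _,_)
open import Data.Sum using (_⊎_; inj₁; inj₂)
open import Function using (_∘_)
open import Relation.Binary.PropositionalEquality
  using (_≡_; _≢_; refl; sym; cong; subst; subst₂)
open import Relation.Nullary using (¬_; yes; no; contradiction)

IsMax-unique : ∀ {P : ℕ → Set} {a b} → IsMax P a → IsMax P b → a ≡ b
IsMax-unique (Pa , maxa) (Pb , maxb) = ℕ.≤-antisym (maxb _ Pa) (maxa _ Pb)

-- FlagSet lam ν i is definitionally FlagSetAbove lam (m ν i).
FlagSetAbove : Seq → ℤ → ℕ → Set
FlagSetAbove lam y j = j ≡ 0 ⊎ (1 ≤ j × y ≤ℤ m lam j)

m≡⊖ : ∀ μ i → m μ i ≡ μ i ⊖ i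
m≡⊖ μ i = ℤ.m-n≡m⊖n (μ i) i

module _ {lam : Seq} (lam-partition : IsPartition lam) where
  open IsPartition lam-partition

  m-suc< : ∀ {c} → 1 ≤ c → m lam (suc c) <ℤ m lam c
  m-suc< {c} 1≤c = subst₂ _<ℤ_ (sym (m≡⊖ lam (suc c))) (sym (m≡⊖ lam c)) (begin-strict
    lam (suc c) ⊖ suc c  ≤⟨ ℤ.⊖-monoˡ-≤ (suc c) (decreasing c 1≤c) ⟩
    lam c ⊖ suc c        <⟨ ℤ.⊖-monoʳ->-< (lam c) (ℕ.n<1+n c) ⟩
    lam c ⊖ c            ∎)
    where open ℤ.≤-Reasoning

  m-strictlyDecreasing : ∀ {a c} → 1 ≤ a → a < c → m lam c <ℤ m lam a
  m-strictlyDecreasing {a} 1≤a a<c = go (ℕ.≤⇒≤′ a<c)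
    where
    go : ∀ {c} → suc a ≤′ c → m lam c <ℤ m lam a
    go ≤′-refl = m-suc< 1≤a
    go {suc c} (≤′-step a<′c) =
      ℤ.<-trans (m-suc< (ℕ.≤-trans 1≤a (ℕ.<⇒≤ (ℕ.≤′⇒≤ a<′c)))) (go a<′c)

  m-antitone : ∀ {a c} → 1 ≤ a → a ≤ c → m lam c ≤ℤ m lam a
  m-antitone 1≤a a≤c with ℕ.m≤n⇒m<n∨m≡n a≤c
  ... | inj₁ a<c  = ℤ.<⇒≤ (m-strictlyDecreasing 1≤a a<c)
  ... | inj₂ refl = ℤ.≤-refl

  isMax-at-Δ : ∀ {p y} → m lam (suc p) ≡ y → IsMax (FlagSetAbove lam y) (suc p)
  isMax-at-Δ {p} refl = inj₂ (s≤s z≤n , ℤ.≤-refl) , bounded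
    where
    bounded : ∀ j → FlagSetAbove lam (m lam (suc p)) j → j ≤ suc p
    bounded j (inj₁ refl) = z≤n
    bounded j (inj₂ (1≤j , above)) with j ≤? suc p
    ... | yes j≤ = j≤
    ... | no j≰ = contradiction above
      (ℤ.<⇒≱ (m-strictlyDecreasing (s≤s z≤n) (ℕ.≰⇒> j≰)))

  isMax-suc-at-Δ : ∀ {p y} → m lam (suc p) ≡ y → IsMax (FlagSetAbove lam (sucℤ y)) p
  isMax-suc-at-Δ {p} refl = predecessor-above p , bounded
    where
    predecessor-above : ∀ q → FlagSetAbove lam (sucℤ (m lam (suc q))) q
    predecessor-above zero    = inj₁ refl
    predecessor-above (suc q) = inj₂ (s≤s z≤n , ℤ.i<j⇒suc[i]≤j (m-suc< (s≤s z≤n)))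
    bounded : ∀ j → FlagSetAbove lam (sucℤ (m lam (suc p))) j → j ≤ p
    bounded j (inj₁ refl) = z≤n
    bounded j (inj₂ (1≤j , above)) with j ≤? p
    ... | yes j≤ = j≤
    ... | no j≰ = contradiction (ℤ.suc[i]≤j⇒i<j above)
      (ℤ.≤⇒≯ (m-antitone (s≤s z≤n) (ℕ.≰⇒> j≰)))

isMax-suc-of-∉Δ : ∀ {lam y b} → ¬ (y ∈Δ lam) →
  IsMax (FlagSetAbove lam y) b → IsMax (FlagSetAbove lam (sucℤ y)) b
isMax-suc-of-∉Δ {lam} {y} {b} y∉Δ (member , bounded) = raised member , λ j → bounded j ∘ lowered j
  where
  raised : FlagSetAbove lam y b → FlagSetAbove lam (sucℤ y) b
  raised (inj₁ b≡0) = inj₁ b≡0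
  raised (inj₂ (1≤b , above)) =
    inj₂ (1≤b , ℤ.i<j⇒suc[i]≤j (ℤ.≤∧≢⇒< above λ y≡ → y∉Δ (b , 1≤b , sym y≡)))
  lowered : ∀ j → FlagSetAbove lam (sucℤ y) j → FlagSetAbove lam y j
  lowered j (inj₁ j≡0) = inj₁ j≡0
  lowered j (inj₂ (1≤j , above)) = inj₂ (1≤j , ℤ.≤-trans (ℤ.i≤suc[i] y) above)

plus-self : ∀ μ k → plus μ k k ≡ suc (μ k)
plus-self μ k with k ≟ k
... | yes _  = refl
... | no k≢k = contradiction refl k≢k

plus-other : ∀ μ k i → i ≢ k → plus μ k i ≡ μ i
plus-other μ k i i≢k with i ≟ k
... | yes i≡k = contradiction i≡k i≢k
... | no _    = refl

m-plus-self : ∀ μ k → m (plus μ k) k ≡ sucℤ (m μ k)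
m-plus-self μ k rewrite plus-self μ k = ℤ.+-assoc (+ 1) (+ μ k) (- + k)

m-plus-other : ∀ μ k i → i ≢ k → m (plus μ k) i ≡ m μ i
m-plus-other μ k i i≢k = cong (λ v → + v - + i) (plus-other μ k i i≢k)

iverson-self : ∀ k → iverson k k ≡ 1
iverson-self k with k ≟ k
... | yes _  = refl
... | no k≢k = contradiction refl k≢k

iverson-other : ∀ k i → i ≢ k → iverson k i ≡ 0
iverson-other k i i≢k with k ≟ i
... | yes k≡i = contradiction (sym k≡i) i≢k
... | no _    = refl

lemma10p15 : (lam μ : Seq) → IsPartition lam → IsPartition μ →
    (k : ℕ) → ER μ k →
    (b bs : ℕ → ℕ) →
    (∀ i → 1 ≤ i → IsFlag lam μ i (b i)) →
    (∀ i → 1 ≤ i → IsFlag lam (plus μ k) i (bs i)) →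
    ((¬ (m μ k ∈Δ lam) → ∀ i → 1 ≤ i → bs i ≡ b i)
    × (m μ k ∈Δ lam → ∀ i → 1 ≤ i → + bs i ≡ + b i - + iverson k i)
    × (∀ i → 1 ≤ i → i ≢ k → bs i ≡ b i))
lemma10p15 lam μ lam-partition _ k _ b bs b-flag bs-flag = part-a , part-b , part-c
  where
  bs-flag-at-k : 1 ≤ k → IsMax (FlagSetAbove lam (sucℤ (m μ k))) (bs k)
  bs-flag-at-k 1≤k = subst (λ y → IsMax (FlagSetAbove lam y) (bs k)) (m-plus-self μ k) (bs-flag k 1≤k)

  part-c : ∀ i → 1 ≤ i → i ≢ k → bs i ≡ b i
  part-c i 1≤i i≢k = IsMax-unique
    (subst (λ y → IsMax (FlagSetAbove lam y) (bs i)) (m-plus-other μ k i i≢k) (bs-flag i 1≤i))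
    (b-flag i 1≤i)

  part-a : ¬ (m μ k ∈Δ lam) → ∀ i → 1 ≤ i → bs i ≡ b i
  part-a mk∉Δ i 1≤i with i ≟ k
  ... | yes refl = IsMax-unique (bs-flag-at-k 1≤i) (isMax-suc-of-∉Δ mk∉Δ (b-flag i 1≤i))
  ... | no i≢k   = part-c i 1≤i i≢k

  part-b : m μ k ∈Δ lam → ∀ i → 1 ≤ i → + bs i ≡ + b i - + iverson k i
  part-b (suc p , _ , λj≡mk) i 1≤i with i ≟ k
  ... | yes refl rewrite iverson-self i
                       | IsMax-unique (b-flag i 1≤i) (isMax-at-Δ lam-partition λj≡mk)
                       | IsMax-unique (bs-flag-at-k 1≤i) (isMax-suc-at-Δ lam-partition λj≡mk) = refl
  ... | no i≢k   rewrite iverson-other k i i≢k | part-c i 1≤i i≢k = sym (ℤ.+-identityʳ (+ b i))
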